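{- Let $\mathcal{R}$ be a countably infinite standard distance monoid and let $\mathbb{U}=\mathbb{U}_{\mathcal{R}}$. Then $\mathrm{IE}(\mathbb{U})$ is spreading: for every sufficiently small $\epsilon\in R\setminus\{0\}$ and every $a\in\mathbb{U}$ there are $\sigma,\theta\in\mathrm{IE}(\mathbb{U})$ with $a\in\mathrm{im}(\sigma)\cap\mathrm{im}(\theta)$ and $\mathrm{im}(\sigma)\cap B_\epsilon(\mathrm{im}(\theta))\subseteq B_\epsilon(a)$.
   Context: A distance monoid $\mathcal{R}=(R,\le,\oplus,0)$ is a commutative monoid with total order such that $r\le r\oplus s$ and $s\le s'\Rightarrow s\oplus t\le s'\oplus t$; standard: whenever $0\ne r$ and $s<r$ there is $0\ne t$ with $s\oplus t<r$. An $\mathcal{R}$-metric space has $d:X^2\to R$ with $d(x,y)=0\iff x=y$, symmetry, and $d(x,z)\le d(x,y)\oplus d(y,z)$. $\mathbb{U}_{\mathcal{R}}$ is the unique (up to isometry) countable $\mathcal{R}$-metric space into which every finite $\mathcal{R}$-metric space embeds and in which every isometry between finite subspaces extends to a global isometry. $\mathrm{IE}(\mathbb{U})$ is the monoid of isometric self-embeddings; $B_\epsilon(a)=\{b:d(a,b)<\epsilon\}$ and $B_\epsilon(Y)=\bigcup_{y\in Y}B_\epsilon(y)$. -}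

module Defs where

open import Data.Nat using (ℕ)
open import Data.Fin using (Fin)
open import Data.Product using (Σ; ∃; ∃-syntax; _×_; _,_)
open import Relation.Nullary using (¬_)
open import Relation.Binary.PropositionalEquality using (_≡_; _≢_)
open import Relation.Binary.Structures using (IsTotalOrder)
open import Function.Bundles using (_↔_)
open import Function.Definitions using (Surjective)

record DistanceMonoid : Set₁ where
  infix  4 _≤_ _<_
  infixl 6 _⊕_
  field
    R        : Set
    _≤_      : R → R → Set
    _⊕_      : R → R → R
    0#       : R
    isTotalOrder : IsTotalOrder _≡_ _≤_
    ⊕-assoc  : ∀ r s t → (r ⊕ s) ⊕ t ≡ r ⊕ (s ⊕ t)
    ⊕-comm   : ∀ r s → r ⊕ s ≡ s ⊕ r
    ⊕-identityˡ : ∀ r → 0# ⊕ r ≡ r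
    ≤-⊕      : ∀ r s → r ≤ r ⊕ s
    ⊕-mono   : ∀ {s s'} t → s ≤ s' → s ⊕ t ≤ s' ⊕ t

  _<_ : R → R → Set
  r < s = r ≤ s × r ≢ s

open DistanceMonoid public

Standard : DistanceMonoid → Set
Standard ℛ = ∀ r s → r ≢ 0# ℛ → _<_ ℛ s r →
  ∃[ t ] (t ≢ 0# ℛ × _<_ ℛ (_⊕_ ℛ s t) r)

CountablyInfinite : DistanceMonoid → Set
CountablyInfinite ℛ = ℕ ↔ R ℛ

record MetricSpace (ℛ : DistanceMonoid) : Set₁ where
  field
    X     : Set
    d     : X → X → R ℛ
    d-zero⇒ : ∀ x y → d x y ≡ 0# ℛ → x ≡ y
    d-refl  : ∀ x → d x x ≡ 0# ℛ
    d-sym   : ∀ x y → d x y ≡ d y x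
    d-tri   : ∀ x y z → _≤_ ℛ (d x z) (_⊕_ ℛ (d x y) (d y z))

open MetricSpace public

module _ {ℛ : DistanceMonoid} where

  IsIsoEmb : (A B : MetricSpace ℛ) → (X A → X B) → Set
  IsIsoEmb A B f = ∀ x y → d B (f x) (f y) ≡ d A x y

  IE : MetricSpace ℛ → Set
  IE U = Σ (X U → X U) (IsIsoEmb U U)

  IsIsometry : (U : MetricSpace ℛ) → (X U → X U) → Set
  IsIsometry U g = IsIsoEmb U U g × Surjective _≡_ _≡_ g

  Countable : MetricSpace ℛ → Set
  Countable U = Σ (ℕ → X U) (Surjective _≡_ _≡_)

  Universal : MetricSpace ℛ → Set₁
  Universal U = ∀ (F : MetricSpace ℛ) (n : ℕ) → (Fin n ↔ X F) →
    Σ (X F → X U) (IsIsoEmb F U)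

  -- every isometry between finite subspaces {p i} → {q i} (p i ↦ q i)
  -- extends to a global isometry
  Ultrahomogeneous : MetricSpace ℛ → Set
  Ultrahomogeneous U = ∀ (n : ℕ) (p q : Fin n → X U) →
    (∀ i j → d U (q i) (q j) ≡ d U (p i) (p j)) →
    Σ (X U → X U) λ g → IsIsometry U g × (∀ i → g (p i) ≡ q i)

  InBall : (U : MetricSpace ℛ) → R ℛ → X U → X U → Set
  InBall U ε a b = _<_ ℛ (d U a b) ε

  Spreading : MetricSpace ℛ → Set
  Spreading U = ∃[ η ] (η ≢ 0# ℛ × (∀ ε → ε ≢ 0# ℛ → _≤_ ℛ ε η →
    ∀ (a : X U) → Σ (IE U) λ σ → Σ (IE U) λ θ →
      (∃[ y ] (Σ.proj₁ σ y ≡ a)) × (∃[ z ] (Σ.proj₁ θ z ≡ a)) ×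
      (∀ x → (∃[ y ] (Σ.proj₁ σ y ≡ x)) →
             (∃[ z ] InBall U ε (Σ.proj₁ θ z) x) →
             InBall U ε a x)))

{-# OPTIONS --safe #-}
module Submission where

-- Glue two copies of U at the point a, putting d(x, a) ⊕ d(a, y) between x in the first
-- copy and y in the second. This free amalgam is a countable pseudometric space, so the
-- one-point extension property of U (universality plus ultrahomogeneity) lets it be built
-- inside U point by point; an isometry moving the image of a back to a then yields σ and θ.
-- Every path from the second copy to the first passes through a, so
-- d(θ z, σ y) ≥ d(a, y) = d(a, σ y), and σ y ∈ B_ε(im θ) forces σ y ∈ B_ε(a) for every ε.

open import Data.Empty using (⊥-elim)
open import Data.Fin using (Fin; zero; suc; toℕ; fromℕ<)
open import Data.Fin.Properties using (any?; toℕ<n; toℕ-fromℕ<)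
open import Data.Nat as ℕ using (ℕ; zero; suc; _⊔_)
import Data.Nat.Properties as ℕ
open import Data.Product using (Σ; ∃; ∃-syntax; _×_; _,_; proj₁; proj₂)
open import Data.Sum using (_⊎_; inj₁; inj₂; swap)
open import Function using (_∘_; Injection; Injective; StrictlySurjective)
open import Function.Consequences.Propositional using (surjective⇒strictlySurjective)
open import Function.Construct.Identity using (↔-id)
open import Function.Construct.Symmetry using (↔-sym)
open import Function.Properties.Inverse using (↔⇒↣)
open import Relation.Binary using (DecidableEquality; IsTotalOrder; Minimum; Poset)
open import Relation.Binary.PropositionalEquality
  using (_≡_; _≢_; refl; sym; trans; cong; cong₂; subst; subst₂; module ≡-Reasoning)
open import Relation.Nullary using (Dec; yes; no)
open import Relation.Nullary.Decidable using (map′)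

open import Defs
  using ( DistanceMonoid; module DistanceMonoid; MetricSpace; module MetricSpace
        ; Standard; CountablyInfinite; Countable; Universal; Ultrahomogeneous
        ; IsIsometry; IE; InBall; Spreading )

module DistanceMonoidProperties (ℛ : DistanceMonoid) where
  open DistanceMonoid ℛ

  poset : Poset _ _ _
  poset = record { isPartialOrder = IsTotalOrder.isPartialOrder isTotalOrder }

  open Poset poset public
    using () renaming (reflexive to ≤-reflexive; trans to ≤-trans; antisym to ≤-antisym)

  ⊕-identityʳ : ∀ r → r ⊕ 0# ≡ r
  ⊕-identityʳ r = trans (⊕-comm r 0#) (⊕-identityˡ r)

  0#-minimum : Minimum _≤_ 0#
  0#-minimum r = subst (0# ≤_) (⊕-identityˡ r) (≤-⊕ 0# r)

  ⊕-monoʳ-≤ : ∀ t {s s′} → s ≤ s′ → t ⊕ s ≤ t ⊕ s′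
  ⊕-monoʳ-≤ t {s} {s′} s≤s′ = subst₂ _≤_ (⊕-comm s t) (⊕-comm s′ t) (⊕-mono t s≤s′)

  ⊕-mono-≤ : ∀ {r r′ s s′} → r ≤ r′ → s ≤ s′ → r ⊕ s ≤ r′ ⊕ s′
  ⊕-mono-≤ {r′ = r′} {s} r≤r′ s≤s′ = ≤-trans (⊕-mono s r≤r′) (⊕-monoʳ-≤ r′ s≤s′)

  r≤s⊕r : ∀ r s → r ≤ s ⊕ r
  r≤s⊕r r s = subst (r ≤_) (⊕-comm r s) (≤-⊕ r s)

  ≡0#⇒⊕-identityˡ : ∀ {r} s → r ≡ 0# → r ⊕ s ≡ s
  ≡0#⇒⊕-identityˡ s refl = ⊕-identityˡ s

  record IsPseudometric {V : Set} (ρ : V → V → R) : Set where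
    field
      diagonal  : ∀ v → ρ v v ≡ 0#
      symmetric : ∀ v v′ → ρ v v′ ≡ ρ v′ v
      triangle  : ∀ u v w → ρ u w ≤ ρ u v ⊕ ρ v w

  module _ (ℕ↔R : CountablyInfinite ℛ) where

    countablyInfinite⇒decidableEquality : DecidableEquality R
    countablyInfinite⇒decidableEquality = ℕ.eq? (↔⇒↣ (↔-sym ℕ↔R))

    countablyInfinite⇒nonzero : ∃[ η ] η ≢ 0#
    countablyInfinite⇒nonzero = pick (to 0 ≟ 0#)
      where
      open Injection (↔⇒↣ ℕ↔R)
      _≟_ : DecidableEquality R
      _≟_ = countablyInfinite⇒decidableEquality
      pick : Dec (to 0 ≡ 0#) → ∃[ η ] η ≢ 0#
      pick (no  to0≢0#) = to 0 , to0≢0#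
      pick (yes to0≡0#) = to 1 , λ to1≡0# → ℕ.1+n≢0 (injective (trans to1≡0# (sym to0≡0#)))

record Deduplication {A : Set} {n : ℕ} (p : Fin n → A) : Set where
  field
    size      : ℕ
    index     : Fin size → Fin n
    injective : Injective _≡_ _≡_ (p ∘ index)
    covers    : ∀ i → ∃ λ j → p (index j) ≡ p i

deduplicate : {A : Set} → DecidableEquality A → ∀ {n} (p : Fin n → A) → Deduplication p
deduplicate _≟_ {zero}  p = record { size = 0 ; index = λ () ; injective = λ { {()} } ; covers = λ () }
deduplicate _≟_ {suc n} p = extend (any? λ j → p (suc (D.index j)) ≟ p zero)
  where
  module D = Deduplication (deduplicate _≟_ (p ∘ suc))

  extend : Dec (∃ λ j → p (suc (D.index j)) ≡ p zero) → Deduplication p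
  extend (yes (j₀ , e₀)) = record
    { size      = D.size
    ; index     = suc ∘ D.index
    ; injective = D.injective
    ; covers    = λ { zero → j₀ , e₀ ; (suc i) → D.covers i }
    }
  extend (no p₀-new) = record
    { size      = suc D.size
    ; index     = index
    ; injective = injective
    ; covers    = covers
    }
    where
    index : Fin (suc D.size) → Fin (suc n)
    index zero    = zero
    index (suc j) = suc (D.index j)

    injective : Injective _≡_ _≡_ (p ∘ index)
    injective {zero}  {zero}  _ = refl
    injective {zero}  {suc j} e = ⊥-elim (p₀-new (j , sym e))
    injective {suc i} {zero}  e = ⊥-elim (p₀-new (i , e))
    injective {suc i} {suc j} e = cong suc (D.injective e)

    covers : ∀ i → ∃ λ j → p (index j) ≡ p i
    covers zero    = zero , refl
    covers (suc i) = let j , e = D.covers i in suc j , e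

-- interleave f g enumerates f 0, g 0, f 1, g 1, …
interleave : {A B : Set} → (ℕ → A) → (ℕ → B) → ℕ → A ⊎ B
interleave f g zero    = inj₁ (f 0)
interleave f g (suc n) = swap (interleave g (f ∘ suc) n)

interleave-hits-inj₁ : {A B : Set} (f : ℕ → A) (g : ℕ → B) → ∀ k → ∃ λ n → interleave f g n ≡ inj₁ (f k)
interleave-hits-inj₂ : {A B : Set} (f : ℕ → A) (g : ℕ → B) → ∀ k → ∃ λ n → interleave f g n ≡ inj₂ (g k)

interleave-hits-inj₁ f g zero    = 0 , refl
interleave-hits-inj₁ f g (suc k) = let n , e = interleave-hits-inj₂ g (f ∘ suc) k in suc n , cong swap e

interleave-hits-inj₂ f g k = let n , e = interleave-hits-inj₁ g (f ∘ suc) k in suc n , cong swap e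

interleave-strictlySurjective : {A B : Set} {f : ℕ → A} {g : ℕ → B} →
  StrictlySurjective _≡_ f → StrictlySurjective _≡_ g → StrictlySurjective _≡_ (interleave f g)
interleave-strictlySurjective {f = f} {g} f-surj g-surj (inj₁ x) with f-surj x
... | k , refl = interleave-hits-inj₁ f g k
interleave-strictlySurjective {f = f} {g} f-surj g-surj (inj₂ y) with g-surj y
... | k , refl = interleave-hits-inj₂ f g k

module Katetov {ℛ : DistanceMonoid} (U : MetricSpace ℛ) where
  open DistanceMonoid ℛ
  open DistanceMonoidProperties ℛ
  open MetricSpace U

  Realises : ∀ {n} → X → (Fin n → X) → (Fin n → R) → Set
  Realises u p r = ∀ i → d u (p i) ≡ r i

  record IsKatetov {n} (p : Fin n → X) (r : Fin n → R) : Set where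
    field
      lipschitz : ∀ i j → r j ≤ r i ⊕ d (p i) (p j)
      bounded   : ∀ i j → d (p i) (p j) ≤ r i ⊕ r j

    same-point⇒≤ : ∀ {i j} → p i ≡ p j → r i ≤ r j
    same-point⇒≤ {i} {j} pᵢ≡pⱼ = subst (r i ≤_) rⱼ⊕0#≡rⱼ (lipschitz j i)
      where
      rⱼ⊕0#≡rⱼ : r j ⊕ d (p j) (p i) ≡ r j
      rⱼ⊕0#≡rⱼ = begin
        r j ⊕ d (p j) (p i) ≡⟨ cong (λ x → r j ⊕ d (p j) x) pᵢ≡pⱼ ⟩
        r j ⊕ d (p j) (p j) ≡⟨ cong (r j ⊕_) (d-refl (p j)) ⟩
        r j ⊕ 0#            ≡⟨ ⊕-identityʳ (r j) ⟩
        r j                 ∎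
        where open ≡-Reasoning

    same-point⇒≡ : ∀ {i j} → p i ≡ p j → r i ≡ r j
    same-point⇒≡ pᵢ≡pⱼ = ≤-antisym (same-point⇒≤ pᵢ≡pⱼ) (same-point⇒≤ (sym pᵢ≡pⱼ))

    realised-at-zero : ∀ {i} → r i ≡ 0# → Realises (p i) p r
    realised-at-zero {i} rᵢ≡0# j = ≤-antisym
      (subst (d (p i) (p j) ≤_) (≡0#⇒⊕-identityˡ (r j) rᵢ≡0#) (bounded i j))
      (subst (r j ≤_) (≡0#⇒⊕-identityˡ (d (p i) (p j)) rᵢ≡0#) (lipschitz i j))

    reindex : ∀ {m} (ι : Fin m → Fin n) → IsKatetov (p ∘ ι) (r ∘ ι)
    reindex ι = record
      { lipschitz = λ i j → lipschitz (ι i) (ι j)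
      ; bounded   = λ i j → bounded (ι i) (ι j)
      }

  pseudometric-katetov : ∀ {V : Set} {ρ : V → V → R} → IsPseudometric ρ →
    ∀ {n} {p : Fin n → X} {v : Fin n → V} → (∀ i j → d (p i) (p j) ≡ ρ (v i) (v j)) →
    ∀ v₀ → IsKatetov p (λ i → ρ v₀ (v i))
  pseudometric-katetov {ρ = ρ} ρ-pseudo {v = v} p≅v v₀ = record
    { lipschitz = λ i j → subst (λ x → ρ v₀ (v j) ≤ ρ v₀ (v i) ⊕ x) (sym (p≅v i j))
                                (triangle v₀ (v i) (v j))
    ; bounded   = λ i j → subst₂ _≤_ (sym (p≅v i j)) (cong (_⊕ ρ v₀ (v j)) (symmetric (v i) v₀))
                                 (triangle (v i) v₀ (v j))
    }
    where open IsPseudometric ρ-pseudo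

  module OnePointExtension {m} {p : Fin m → X} {r : Fin m → R}
      (p-injective : Injective _≡_ _≡_ p) (r≢0# : ∀ i → r i ≢ 0#) (K : IsKatetov p r) where
    open IsKatetov K

    δ : Fin (suc m) → Fin (suc m) → R
    δ zero    zero    = 0#
    δ zero    (suc j) = r j
    δ (suc i) zero    = r i
    δ (suc i) (suc j) = d (p i) (p j)

    δ-zero⇒ : ∀ x y → δ x y ≡ 0# → x ≡ y
    δ-zero⇒ zero    zero    _ = refl
    δ-zero⇒ zero    (suc j) e = ⊥-elim (r≢0# j e)
    δ-zero⇒ (suc i) zero    e = ⊥-elim (r≢0# i e)
    δ-zero⇒ (suc i) (suc j) e = cong suc (p-injective (d-zero⇒ (p i) (p j) e))

    δ-refl : ∀ x → δ x x ≡ 0#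
    δ-refl zero    = refl
    δ-refl (suc i) = d-refl (p i)

    δ-sym : ∀ x y → δ x y ≡ δ y x
    δ-sym zero    zero    = refl
    δ-sym zero    (suc j) = refl
    δ-sym (suc i) zero    = refl
    δ-sym (suc i) (suc j) = d-sym (p i) (p j)

    δ-tri : ∀ x y z → δ x z ≤ δ x y ⊕ δ y z
    δ-tri zero    zero    zero    = 0#-minimum _
    δ-tri zero    zero    (suc k) = ≤-reflexive (sym (⊕-identityˡ (r k)))
    δ-tri zero    (suc j) zero    = 0#-minimum _
    δ-tri zero    (suc j) (suc k) = lipschitz j k
    δ-tri (suc i) zero    zero    = ≤-⊕ (r i) 0#
    δ-tri (suc i) zero    (suc k) = bounded i k
    δ-tri (suc i) (suc j) zero    =
      subst (r i ≤_) (trans (⊕-comm _ _) (cong (_⊕ r j) (d-sym (p j) (p i)))) (lipschitz j i)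
    δ-tri (suc i) (suc j) (suc k) = d-tri (p i) (p j) (p k)

    space : MetricSpace ℛ
    space = record
      { X = Fin (suc m) ; d = δ ; d-zero⇒ = δ-zero⇒ ; d-refl = δ-refl ; d-sym = δ-sym ; d-tri = δ-tri }

  module Extension (universal : Universal U) (homogeneous : Ultrahomogeneous U) where

    realise-injective : ∀ {m} {p : Fin m → X} {r : Fin m → R} → Injective _≡_ _≡_ p →
      (∀ i → r i ≢ 0#) → IsKatetov p r → ∃ λ u → Realises u p r
    realise-injective {m} {p} {r} p-injective r≢0# K =
      let f , f-iso = universal space (suc m) (↔-id _)
          g , (g-iso , _) , g∘f≡p = homogeneous m (f ∘ suc) p (λ i j → sym (f-iso (suc i) (suc j)))
      in g (f zero) , λ i → begin
        d (g (f zero)) (p i)             ≡⟨ cong (d (g (f zero))) (g∘f≡p i) ⟨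
        d (g (f zero)) (g (f (suc i)))   ≡⟨ g-iso (f zero) (f (suc i)) ⟩
        d (f zero) (f (suc i))           ≡⟨ f-iso zero (suc i) ⟩
        r i                              ∎
      where
      open OnePointExtension p-injective r≢0# K
      open ≡-Reasoning

    module _ (_≟_ : DecidableEquality R) where

      _≟ₓ_ : DecidableEquality X
      x ≟ₓ y = map′ (d-zero⇒ x y) (λ { refl → d-refl x }) (d x y ≟ 0#)

      realise : ∀ {n} {p : Fin n → X} {r : Fin n → R} → IsKatetov p r → ∃ λ u → Realises u p r
      realise {n} {p} {r} K = cases (any? λ i → r i ≟ 0#)
        where
        open IsKatetov K
        open Deduplication (deduplicate _≟ₓ_ p)

        cases : Dec (∃ λ i → r i ≡ 0#) → ∃ λ u → Realises u p r
        cases (yes (i , rᵢ≡0#)) = p i , realised-at-zero rᵢ≡0#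
        cases (no no-zero) =
          let u , u-realises = realise-injective injective (λ j rⱼ≡0# → no-zero (index j , rⱼ≡0#))
                                                 (reindex index)
          in u , λ i → let j , e = covers i in begin
            d u (p i)         ≡⟨ cong (d u) e ⟨
            d u (p (index j)) ≡⟨ u-realises j ⟩
            r (index j)       ≡⟨ same-point⇒≡ e ⟩
            r i               ∎
          where open ≡-Reasoning

module PseudometricEmbedding {ℛ : DistanceMonoid} (U : MetricSpace ℛ)
    (universal : Universal U) (homogeneous : Ultrahomogeneous U)
    (_≟_ : DecidableEquality (DistanceMonoid.R ℛ))
    {V : Set} {ρ : V → V → DistanceMonoid.R ℛ} (ρ-pseudo : DistanceMonoidProperties.IsPseudometric ℛ ρ)
    (w : ℕ → V) (w-surjective : StrictlySurjective _≡_ w) (x₀ : MetricSpace.X U) where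
  open DistanceMonoid ℛ
  open MetricSpace U
  open Katetov U
  open Extension universal homogeneous
  open DistanceMonoidProperties.IsPseudometric ρ-pseudo

  IsometricBelow : ℕ → (ℕ → X) → Set
  IsometricBelow n g = ∀ {i j} → i ℕ.< n → j ℕ.< n → d (g i) (g j) ≡ ρ (w i) (w j)

  Approximation : ℕ → Set
  Approximation n = Σ (ℕ → X) (IsometricBelow n)

  next-point : ∀ n {g} → IsometricBelow n g → ∃ λ u → ∀ {i} → i ℕ.< n → d u (g i) ≡ ρ (w n) (w i)
  next-point n {g} g-iso =
    let u , u-realises = realise _≟_ (pseudometric-katetov ρ-pseudo {p = g ∘ toℕ} {v = w ∘ toℕ}
                                       (λ i j → g-iso (toℕ<n i) (toℕ<n j)) (w n))
    in u , λ i<n → subst (λ k → d u (g k) ≡ ρ (w n) (w k)) (toℕ-fromℕ< i<n) (u-realises (fromℕ< i<n))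

  _[_≔_] : (ℕ → X) → ℕ → X → ℕ → X
  (g [ n ≔ u ]) k with k ℕ.≟ n
  ... | yes _ = u
  ... | no  _ = g k

  update-≡ : ∀ g n u → (g [ n ≔ u ]) n ≡ u
  update-≡ g n u with n ℕ.≟ n
  ... | yes _   = refl
  ... | no  n≢n = ⊥-elim (n≢n refl)

  update-≢ : ∀ g n u {k} → k ≢ n → (g [ n ≔ u ]) k ≡ g k
  update-≢ g n u {k} k≢n with k ℕ.≟ n
  ... | yes k≡n = ⊥-elim (k≢n k≡n)
  ... | no  _   = refl

  extend : ∀ n → Approximation n → Approximation (suc n)
  extend n (g , g-iso) = g′ , g′-iso
    where
    new : ∃ λ u → ∀ {i} → i ℕ.< n → d u (g i) ≡ ρ (w n) (w i)
    new = next-point n g-iso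

    u : X
    u = proj₁ new

    g′ : ℕ → X
    g′ = g [ n ≔ u ]

    old : ∀ {i} → i ℕ.< n → g′ i ≡ g i
    old i<n = update-≢ g n u (ℕ.<⇒≢ i<n)

    from-new : ∀ {j} → j ℕ.< suc n → d (g′ n) (g′ j) ≡ ρ (w n) (w j)
    from-new {j} j<1+n with ℕ.m<1+n⇒m<n∨m≡n j<1+n
    ... | inj₁ j<n  = trans (cong₂ d (update-≡ g n u) (old j<n)) (proj₂ new j<n)
    ... | inj₂ refl = trans (d-refl (g′ n)) (sym (diagonal (w n)))

    g′-iso : IsometricBelow (suc n) g′
    g′-iso {i} {j} i<1+n j<1+n with ℕ.m<1+n⇒m<n∨m≡n i<1+n | ℕ.m<1+n⇒m<n∨m≡n j<1+n
    ... | inj₂ refl | _         = from-new j<1+n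
    ... | inj₁ i<n  | inj₂ refl =
      trans (d-sym (g′ i) (g′ n)) (trans (from-new i<1+n) (symmetric (w n) (w i)))
    ... | inj₁ i<n  | inj₁ j<n  = trans (cong₂ d (old i<n) (old j<n)) (g-iso i<n j<n)

  approximation : ∀ n → Approximation n
  approximation zero    = (λ _ → x₀) , λ ()
  approximation (suc n) = extend n (approximation n)

  limit : ℕ → X
  limit k = proj₁ (approximation (suc k)) k

  approximation-stable : ∀ n {i} → i ℕ.< n → proj₁ (approximation n) i ≡ limit i
  approximation-stable (suc n) i<1+n with ℕ.m<1+n⇒m<n∨m≡n i<1+n
  ... | inj₁ i<n  = trans (update-≢ _ n _ (ℕ.<⇒≢ i<n)) (approximation-stable n i<n)
  ... | inj₂ refl = refl

  limit-isometric : ∀ i j → d (limit i) (limit j) ≡ ρ (w i) (w j)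
  limit-isometric i j = trans
    (cong₂ d (sym (approximation-stable n i<n)) (sym (approximation-stable n j<n)))
    (proj₂ (approximation n) i<n j<n)
    where
    n : ℕ
    n = suc (i ⊔ j)

    i<n : i ℕ.< n
    i<n = ℕ.s≤s (ℕ.m≤m⊔n i j)

    j<n : j ℕ.< n
    j<n = ℕ.s≤s (ℕ.m≤n⊔m i j)

  embed : Σ (V → X) λ f → ∀ v v′ → d (f v) (f v′) ≡ ρ v v′
  embed = limit ∘ index , λ v v′ →
    trans (limit-isometric (index v) (index v′))
          (cong₂ ρ (proj₂ (w-surjective v)) (proj₂ (w-surjective v′)))
    where
    index : V → ℕ
    index v = proj₁ (w-surjective v)

module Spreads {ℛ : DistanceMonoid} (U : MetricSpace ℛ) where
  open DistanceMonoid ℛ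
  open MetricSpace U

  SpreadsAt : R → X → IE U → IE U → Set
  SpreadsAt ε a σ θ =
    (∃[ y ] proj₁ σ y ≡ a) × (∃[ z ] proj₁ θ z ≡ a) ×
    (∀ x → (∃[ y ] proj₁ σ y ≡ x) → (∃[ z ] InBall U ε (proj₁ θ z) x) → InBall U ε a x)

  _∘ᵉ_ : IE U → IE U → IE U
  (g , g-iso) ∘ᵉ (f , f-iso) = g ∘ f , λ x y → trans (g-iso (f x) (f y)) (f-iso x y)

  spreadsAt-∘ : ∀ {ε b} (g σ θ : IE U) → SpreadsAt ε b σ θ → SpreadsAt ε (proj₁ g b) (g ∘ᵉ σ) (g ∘ᵉ θ)
  spreadsAt-∘ {ε} {b} (g , g-iso) (σ , _) (θ , _) ((y , σy≡b) , (z , θz≡b) , separated) =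
    (y , cong g σy≡b) , (z , cong g θz≡b) , λ { _ (y′ , refl) (z′ , close) →
      subst (_< ε) (sym (g-iso b (σ y′)))
        (separated (σ y′) (y′ , refl) (z′ , subst (_< ε) (g-iso (θ z′) (σ y′)) close)) }

module FreeAmalgam {ℛ : DistanceMonoid} (U : MetricSpace ℛ) (a : MetricSpace.X U) where
  open DistanceMonoid ℛ
  open DistanceMonoidProperties ℛ
  open MetricSpace U

  via-a : X → X → R
  via-a x y = d x a ⊕ d a y

  amalgam : X ⊎ X → X ⊎ X → R
  amalgam (inj₁ x) (inj₁ y) = d x y
  amalgam (inj₂ x) (inj₂ y) = d x y
  amalgam (inj₁ x) (inj₂ y) = via-a x y
  amalgam (inj₂ x) (inj₁ y) = via-a x y

  via-a-sym : ∀ x y → via-a x y ≡ via-a y x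
  via-a-sym x y = trans (⊕-comm _ _) (cong₂ _⊕_ (d-sym a y) (d-sym x a))

  via-a-triangleˡ : ∀ x y z → via-a x z ≤ d x y ⊕ via-a y z
  via-a-triangleˡ x y z = subst (via-a x z ≤_) (⊕-assoc _ _ _) (⊕-mono (d a z) (d-tri x y a))

  via-a-triangleʳ : ∀ x y z → via-a x z ≤ via-a x y ⊕ d y z
  via-a-triangleʳ x y z = subst (via-a x z ≤_) (sym (⊕-assoc _ _ _)) (⊕-monoʳ-≤ (d x a) (d-tri a y z))

  d≤via-a⊕via-a : ∀ x y z → d x z ≤ via-a x y ⊕ via-a y z
  d≤via-a⊕via-a x y z = ≤-trans (d-tri x a z) (⊕-mono-≤ (≤-⊕ (d x a) (d a y)) (r≤s⊕r (d a z) (d y a)))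

  amalgam-isPseudometric : IsPseudometric amalgam
  amalgam-isPseudometric = record
    { diagonal  = λ { (inj₁ x) → d-refl x ; (inj₂ x) → d-refl x }
    ; symmetric = symmetric
    ; triangle  = triangle
    }
    where
    symmetric : ∀ u v → amalgam u v ≡ amalgam v u
    symmetric (inj₁ x) (inj₁ y) = d-sym x y
    symmetric (inj₂ x) (inj₂ y) = d-sym x y
    symmetric (inj₁ x) (inj₂ y) = via-a-sym x y
    symmetric (inj₂ x) (inj₁ y) = via-a-sym x y

    triangle : ∀ u v w → amalgam u w ≤ amalgam u v ⊕ amalgam v w
    triangle (inj₁ x) (inj₁ y) (inj₁ z) = d-tri x y z
    triangle (inj₂ x) (inj₂ y) (inj₂ z) = d-tri x y z
    triangle (inj₁ x) (inj₁ y) (inj₂ z) = via-a-triangleˡ x y z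
    triangle (inj₂ x) (inj₂ y) (inj₁ z) = via-a-triangleˡ x y z
    triangle (inj₁ x) (inj₂ y) (inj₂ z) = via-a-triangleʳ x y z
    triangle (inj₂ x) (inj₁ y) (inj₁ z) = via-a-triangleʳ x y z
    triangle (inj₁ x) (inj₂ y) (inj₁ z) = d≤via-a⊕via-a x y z
    triangle (inj₂ x) (inj₁ y) (inj₂ z) = d≤via-a⊕via-a x y z

  module _ (F : X ⊎ X → X) (F-iso : ∀ v v′ → d (F v) (F v′) ≡ amalgam v v′) where
    open Spreads U

    copy₁ copy₂ : IE U
    copy₁ = F ∘ inj₁ , λ x y → F-iso (inj₁ x) (inj₁ y)
    copy₂ = F ∘ inj₂ , λ x y → F-iso (inj₂ x) (inj₂ y)

    copies-meet-at-a : F (inj₂ a) ≡ F (inj₁ a)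
    copies-meet-at-a = d-zero⇒ _ _ (begin
      d (F (inj₂ a)) (F (inj₁ a)) ≡⟨ F-iso (inj₂ a) (inj₁ a) ⟩
      d a a ⊕ d a a               ≡⟨ cong₂ _⊕_ (d-refl a) (d-refl a) ⟩
      0# ⊕ 0#                     ≡⟨ ⊕-identityˡ 0# ⟩
      0#                          ∎)
      where open ≡-Reasoning

    copies-spreadAt : ∀ ε → SpreadsAt ε (F (inj₁ a)) copy₁ copy₂
    copies-spreadAt ε = (a , refl) , (a , copies-meet-at-a) , λ { _ (y , refl) (z , close) →
      begin-strict
        d (F (inj₁ a)) (F (inj₁ y)) ≡⟨ F-iso (inj₁ a) (inj₁ y) ⟩
        d a y                       ≤⟨ r≤s⊕r (d a y) (d z a) ⟩
        d z a ⊕ d a y               ≡⟨ F-iso (inj₂ z) (inj₁ y) ⟨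
        d (F (inj₂ z)) (F (inj₁ y)) <⟨ close ⟩
        ε                           ∎ }
      where open import Relation.Binary.Reasoning.PartialOrder poset

module _ {ℛ : DistanceMonoid} (U : MetricSpace ℛ) where
  open DistanceMonoid ℛ
  open MetricSpace U
  open Spreads U

  spreadsAt-everywhere : Countable U → Universal U → Ultrahomogeneous U → DecidableEquality R →
    ∀ ε a → Σ (IE U) λ σ → Σ (IE U) λ θ → SpreadsAt ε a σ θ
  spreadsAt-everywhere (e , e-surjective) universal homogeneous _≟_ ε a =
    g ∘ᵉ copy₁ F F-iso , g ∘ᵉ copy₂ F F-iso ,
    subst (λ b → SpreadsAt ε b (g ∘ᵉ copy₁ F F-iso) (g ∘ᵉ copy₂ F F-iso)) g[Fa]≡a
      (spreadsAt-∘ g (copy₁ F F-iso) (copy₂ F F-iso) (copies-spreadAt F F-iso ε))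
    where
    open FreeAmalgam U a

    enumeration : StrictlySurjective _≡_ (interleave e e)
    enumeration = interleave-strictlySurjective e-strictlySurjective e-strictlySurjective
      where
      e-strictlySurjective : StrictlySurjective _≡_ e
      e-strictlySurjective = surjective⇒strictlySurjective e-surjective

    embedding : Σ (X ⊎ X → X) λ F → ∀ v v′ → d (F v) (F v′) ≡ amalgam v v′
    embedding = PseudometricEmbedding.embed U universal homogeneous _≟_ amalgam-isPseudometric
      (interleave e e) enumeration a

    F : X ⊎ X → X
    F = proj₁ embedding

    F-iso : ∀ v v′ → d (F v) (F v′) ≡ amalgam v v′
    F-iso = proj₂ embedding

    moving-Fa-to-a : Σ (X → X) λ g → IsIsometry U g × (∀ i → g (F (inj₁ a)) ≡ a)
    moving-Fa-to-a =
      homogeneous 1 (λ _ → F (inj₁ a)) (λ _ → a) (λ _ _ → trans (d-refl a) (sym (d-refl _)))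

    g : IE U
    g = proj₁ moving-Fa-to-a , proj₁ (proj₁ (proj₂ moving-Fa-to-a))

    g[Fa]≡a : proj₁ g (F (inj₁ a)) ≡ a
    g[Fa]≡a = proj₂ (proj₂ moving-Fa-to-a) zero

lemma7p23 : (ℛ : DistanceMonoid) → Standard ℛ → CountablyInfinite ℛ →
    (U : MetricSpace ℛ) → Countable U → Universal U → Ultrahomogeneous U →
    Spreading U
lemma7p23 ℛ _ ℕ↔R U countable universal homogeneous =
  let η , η≢0# = countablyInfinite⇒nonzero ℕ↔R in
  η , η≢0# , λ ε _ _ →
    spreadsAt-everywhere U countable universal homogeneous (countablyInfinite⇒decidableEquality ℕ↔R) ε
  where open DistanceMonoidProperties ℛ
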